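{- Let $K$ be a field containing a primitive $n$th root of unity $\beta$, let $U_n=\langle\beta\rangle\subset K^\times$, and let $r\ge 1$. For a multiset $E=\{e_0,\dots,e_r\}\subset\mathbb{Z}/n\mathbb{Z}$ of size $r+1$ put $$\mathcal M_E=\{[t^{e_0}:\cdots:t^{e_r}]: t\in U_n\}\subset\mathrm{PG}(r,K),\qquad S_E=\mathrm{diag}(\beta^{e_0},\dots,\beta^{e_r})\in\mathrm{GL}(r+1,K),$$ and call $E$ regular if $\gcd(n,\{e_i-e_0: 1\le i\le r\})=1$. Let $E=\{e_0,\dots,e_r\}$ and $F=\{f_0,\dots,f_r\}$ be regular multisets in $\mathbb{Z}/n\mathbb{Z}$ of size $r+1$. Assume there exists $P\in\mathrm{PGL}(r+1,K)$ with $P(\mathcal M_E)=\mathcal M_F$ and $P[S_E]P^{ -1}\in\langle[S_F]\rangle$. Then there exist $u\in(\mathbb{Z}/n\mathbb{Z})^\times$ and $v\in\mathbb{Z}/n\mathbb{Z}$ such that $E\equiv v+uF\pmod n$ as unordered multisets in $\mathbb{Z}/n\mathbb{Z}$.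
   Context: For regular $E$, the element $[S_E]\in\mathrm{PGL}(r+1,K)$ acts on $\mathcal M_E$ via $t\mapsto\beta t$ on the parameter, and this action is regular, so $|\mathcal M_E|=n$. -}

module Defs where

open import Level using (Level; _⊔_) renaming (suc to lsuc)
open import Algebra.Bundles using (CommutativeRing; Semiring)
open import Data.Nat as ℕ using (ℕ; zero; suc; _<_)
open import Data.Integer as ℤ using (ℤ; +_)
open import Data.Integer.Divisibility as ℤD using ()
import Data.Nat.Divisibility as ℕD
open import Data.Fin using (Fin; zero; suc; _≟_)
open import Data.Fin.Permutation using (Permutation′; _⟨$⟩ʳ_)
open import Data.Product using (Σ; ∃; _×_; _,_)
open import Relation.Nullary using (¬_; yes; no)
open import Relation.Binary.PropositionalEquality using (_≡_)
import Algebra.Definitions.RawSemiring as RS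
import Algebra.Definitions.RawMonoid as RM

record Field (c ℓ : Level) : Set (lsuc (c ⊔ ℓ)) where
  field
    commutativeRing : CommutativeRing c ℓ
  open CommutativeRing commutativeRing public
  field
    1≉0     : ¬ (1# ≈ 0#)
    inverse : ∀ x → ¬ (x ≈ 0#) → Σ Carrier λ y → x * y ≈ 1#

-- Arithmetic modulo n on natural-number representatives of ℤ/nℤ.

_≡_[mod_] : ℕ → ℕ → ℕ → Set
a ≡ b [mod n ] = (+ n) ℤD.∣ ((+ a) ℤ.- (+ b))

IsUnitMod : ℕ → ℕ → Set
IsUnitMod n u = Σ ℕ λ w → (u ℕ.* w) ≡ 1 [mod n ]

Regular : (n r : ℕ) → (Fin (suc r) → ℕ) → Set
Regular n r e =
  ∀ (d : ℕ) → d ℕD.∣ n → (∀ (i : Fin (suc r)) → (+ d) ℤD.∣ ((+ e i) ℤ.- (+ e zero))) → d ≡ 1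

MultisetAffineEq : (n r : ℕ) → (e f : Fin (suc r) → ℕ) → (u v : ℕ) → Set
MultisetAffineEq n r e f u v =
  Σ (Permutation′ (suc r)) λ σ → ∀ i → e i ≡ (v ℕ.+ u ℕ.* f (σ ⟨$⟩ʳ i)) [mod n ]

module _ {c ℓ : Level} (F : Field c ℓ) where
  open Field F
  open RS (Semiring.rawSemiring semiring) using (_^_)
  open RM (CommutativeRing.+-rawMonoid commutativeRing) using (sum)

  IsPrimitiveRoot : ℕ → Carrier → Set ℓ
  IsPrimitiveRoot n β = (β ^ n ≈ 1#) × (∀ k → 0 < k → k < n → ¬ (β ^ k ≈ 1#))

  Matrix : ℕ → Set c
  Matrix m = Fin m → Fin m → Carrier

  _⊗_ : ∀ {m} → Matrix m → Matrix m → Matrix m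
  (A ⊗ B) i j = sum λ k → A i k * B k j

  _·_ : ∀ {m} → Matrix m → (Fin m → Carrier) → (Fin m → Carrier)
  (A · x) i = sum λ k → A i k * x k

  identityMatrix : ∀ {m} → Matrix m
  identityMatrix i j with i ≟ j
  ... | yes _ = 1#
  ... | no  _ = 0#

  diag : ∀ {m} → (Fin m → Carrier) → Matrix m
  diag d i j with i ≟ j
  ... | yes _ = d i
  ... | no  _ = 0#

  matPow : ∀ {m} → Matrix m → ℕ → Matrix m
  matPow A zero    = identityMatrix
  matPow A (suc k) = A ⊗ matPow A k

  _≈M_ : ∀ {m} → Matrix m → Matrix m → Set ℓ
  A ≈M B = ∀ i j → A i j ≈ B i j

  ProjEq : ∀ {m} → (Fin m → Carrier) → (Fin m → Carrier) → Set (c ⊔ ℓ)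
  ProjEq x y = Σ Carrier λ λ′ → ¬ (λ′ ≈ 0#) × (∀ i → y i ≈ λ′ * x i)

  ProjMatEq : ∀ {m} → Matrix m → Matrix m → Set (c ⊔ ℓ)
  ProjMatEq A B = Σ Carrier λ λ′ → ¬ (λ′ ≈ 0#) × (∀ i j → B i j ≈ λ′ * A i j)

  momentPoint : ∀ {r} → (Fin (suc r) → ℕ) → Carrier → (Fin (suc r) → Carrier)
  momentPoint e t i = t ^ e i

  S : ∀ {r} → Carrier → (Fin (suc r) → ℕ) → Matrix (suc r)
  S β e = diag λ i → β ^ e i

  -- P(M_E) = M_F, where P = [A], M_E = {[t^{e_i}]_i : t ∈ U_n},
  -- U_n = ⟨β⟩ = {β^k : k ∈ ℕ}
  MapsMomentSet : ∀ {r} → Carrier → Matrix (suc r) → (Fin (suc r) → ℕ) → (Fin (suc r) → ℕ) → Set (c ⊔ ℓ)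
  MapsMomentSet β A e f =
    (∀ k → Σ ℕ λ l → ProjEq (A · momentPoint e (β ^ k)) (momentPoint f (β ^ l)))
    × (∀ l → Σ ℕ λ k → ProjEq (A · momentPoint e (β ^ k)) (momentPoint f (β ^ l)))

  -- [A][S_E][A]⁻¹ ∈ ⟨[S_F]⟩, with B a two-sided inverse of A
  ConjInCyclic : ∀ {r} → Carrier → Matrix (suc r) → Matrix (suc r) → (Fin (suc r) → ℕ) → (Fin (suc r) → ℕ) → Set (c ⊔ ℓ)
  ConjInCyclic β A B e f =
    Σ ℕ λ m → ProjMatEq ((A ⊗ S β e) ⊗ B) (matPow (S β f) m)

-- Write P = [A] with B A = 1. The conjugation hypothesis says S_F^m A = μ A S_E, i.e. A intertwines
-- diag(μ β^e_j) with diag(β^(m f_i)). An invertible matrix intertwines two diagonal matrices only if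
-- their entries agree up to a permutation σ: some entry A i 0 is nonzero, which forces
-- μ β^e_0 = β^(m f_i), and the Schur complement of that pivot intertwines the remaining entries.
-- As β has order exactly n, comparing μ β^e_j = β^(m f_σj) with the case j = 0 gives
-- e_j ≡ v + m f_σj (mod n) for v = e_0 - m f_σ0. Every common divisor of m and n then divides all
-- e_j - e_0, so the regularity of E makes m a unit modulo n.
--
-- Over an arbitrary field one cannot decide which pivot is nonzero, so σ is first obtained under
-- double negation, and then extracted because the congruences it yields are decidable.

module Submission where

open import Defs
open import Level using (Level)
open import Data.Nat using (ℕ; suc; _≤_)
open import Data.Fin using (Fin)
open import Data.Product using (Σ; _×_)

open import Data.Nat as ℕ using (zero; pred; NonZero; _<_; z≤n; s≤s)
import Data.Nat.Properties as ℕ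
open import Data.Nat.DivMod
  using (_%_; _/_; m≡m%n+[m/n]*n; m%n<n; %-distribˡ-+; [m+kn]%n≡m%n; m∣n⇒o%n%m≡o%m; %-remove-+ʳ)
open import Data.Nat.Divisibility as ℕ using (∣m⇒∣m*n)
open import Data.Nat.Coprimality using (Coprime; coprime-Bézout)
open import Data.Nat.GCD using (module Bézout)
import Data.Nat.Tactic.RingSolver as ℕ-Solver
open import Data.Integer as ℤ using (+_)
import Data.Integer.Properties as ℤ
import Data.Integer.Divisibility.Signed as ℤ
import Data.Integer.Tactic.RingSolver as ℤ-Solver
open import Data.Fin using (zero; suc; punchIn; _≟_)
open import Data.Fin.Properties using (any?; sequence; punchInᵢ≢i)
open import Data.Fin.Permutation as Permutation using (Permutation′; _⟨$⟩ʳ_; insert; insert-punchIn)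
open import Data.Product using (_,_; proj₁; proj₂)
open import Data.Sum using (inj₁; inj₂)
open import Data.Unit.Polymorphic using (⊤; tt)
open import Data.Empty using (⊥-elim)
open import Function using (_∘_)
open import Effect.Monad using (RawMonad)
open import Relation.Nullary using (¬_; Dec; yes; no; contradiction)
open import Relation.Nullary.Decidable using (_×-dec_; decidable-stable)
open import Relation.Nullary.Negation using (¬¬-Monad; ¬¬-map)
open import Relation.Binary.PropositionalEquality as ≡ using (_≡_; _≢_; cong; cong₂)

-- Unlike Σ σ (∀ j → R j (σ ⟨$⟩ʳ j)), this presentation of a perfect matching is decidable
-- whenever R is.
Matching : ∀ {p} n → (Fin n → Fin n → Set p) → Set p
Matching zero    R = ⊤
Matching (suc n) R = Σ (Fin (suc n)) λ i → R zero i × Matching n (λ j k → R (suc j) (punchIn i k))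

mapMatching : ∀ {p q n} {R : Fin n → Fin n → Set p} {R′ : Fin n → Fin n → Set q} →
              (∀ j i → R j i → R′ j i) → Matching n R → Matching n R′
mapMatching {n = zero}  f _               = tt
mapMatching {n = suc _} f (i , r₀ , rest) = i , f zero i r₀ , mapMatching (λ j k → f (suc j) (punchIn i k)) rest

matching? : ∀ {p n} {R : Fin n → Fin n → Set p} → (∀ j i → Dec (R j i)) → Dec (Matching n R)
matching? {n = zero}  R? = yes tt
matching? {n = suc _} R? = any? λ i → R? zero i ×-dec matching? (λ j k → R? (suc j) (punchIn i k))

matching⇒permutation : ∀ {p n} {R : Fin n → Fin n → Set p} → Matching n R →
                       Σ (Permutation′ n) λ σ → ∀ j → R j (σ ⟨$⟩ʳ j)
matching⇒permutation {n = zero}  _ = Permutation.id , λ ()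
matching⇒permutation {n = suc _} {R = R} (i , r₀ , rest) with matching⇒permutation rest
... | σ , σ-matches = insert zero i σ , λ where
  zero    → r₀
  (suc j) → ≡.subst (R (suc j)) (≡.sym (insert-punchIn zero i σ j)) (σ-matches j)

module ModularArithmetic where
  open import Data.Nat using (_+_; _*_)

  %≡%⇒≡[mod] : ∀ {n} x y .{{_ : NonZero n}} → x % n ≡ y % n → x ≡ y [mod n ]
  %≡%⇒≡[mod] {n} x y x%n≡y%n = ℤ.∣⇒∣ᵤ (ℤ.divides (+ (x / n) ℤ.- + (y / n)) (begin
      + x ℤ.- + y
        ≡⟨ cong₂ (λ a b → + a ℤ.- + b) (m≡m%n+[m/n]*n x n) (m≡m%n+[m/n]*n y n) ⟩
      + (x % n + x / n * n) ℤ.- + (y % n + y / n * n)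
        ≡⟨ cong (λ r → + (x % n + x / n * n) ℤ.- + (r + y / n * n)) (≡.sym x%n≡y%n) ⟩
      + (x % n + x / n * n) ℤ.- + (x % n + y / n * n)
        ≡⟨ cong₂ ℤ._-_ (+-split (x % n) (x / n)) (+-split (x % n) (y / n)) ⟩
      (+ (x % n) ℤ.+ + (x / n) ℤ.* + n) ℤ.- (+ (x % n) ℤ.+ + (y / n) ℤ.* + n)
        ≡⟨ difference-of-multiples (+ (x % n)) (+ (x / n)) (+ (y / n)) (+ n) ⟩
      (+ (x / n) ℤ.- + (y / n)) ℤ.* + n ∎))
    where
    open ≡.≡-Reasoning
    +-split : ∀ r q → + (r + q * n) ≡ + r ℤ.+ + q ℤ.* + n
    +-split r q = ≡.trans (ℤ.pos-+ r (q * n)) (cong (ℤ._+_ (+ r)) (ℤ.pos-* q n))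
    difference-of-multiples : ∀ r a b n → (r ℤ.+ a ℤ.* n) ℤ.- (r ℤ.+ b ℤ.* n) ≡ (a ℤ.- b) ℤ.* n
    difference-of-multiples = ℤ-Solver.solve-∀

  %-cong-+ʳ : ∀ {n x x′} y .{{_ : NonZero n}} → x % n ≡ x′ % n → (x + y) % n ≡ (x′ + y) % n
  %-cong-+ʳ {n} {x} {x′} y x≡x′ = begin
    (x + y) % n             ≡⟨ %-distribˡ-+ x y n ⟩
    (x % n + y % n) % n     ≡⟨ cong (λ r → (r + y % n) % n) x≡x′ ⟩
    (x′ % n + y % n) % n    ≡⟨ %-distribˡ-+ x′ y n ⟨
    (x′ + y) % n            ∎
    where open ≡.≡-Reasoning

  -- ℕ has no negatives: pred n * c stands for - c modulo n.
  %-transpose : ∀ {n} a b c d .{{_ : NonZero n}} →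
                (b + c) % n ≡ (a + d) % n → b % n ≡ ((a + pred n * c) + d) % n
  %-transpose {n@(suc n′)} a b c d b+c≡a+d = begin
    b % n                       ≡⟨ [m+kn]%n≡m%n b c n ⟨
    (b + c * n) % n             ≡⟨ cong (_% n) (absorb b c n′) ⟩
    ((b + c) + n′ * c) % n      ≡⟨ %-cong-+ʳ {x = b + c} {a + d} (n′ * c) b+c≡a+d ⟩
    ((a + d) + n′ * c) % n      ≡⟨ cong (_% n) (swap a d (n′ * c)) ⟩
    ((a + n′ * c) + d) % n      ∎
    where
    open ≡.≡-Reasoning
    absorb : ∀ b c n′ → b + c * suc n′ ≡ (b + c) + n′ * c
    absorb = ℕ-Solver.solve-∀
    swap : ∀ a d x → (a + d) + x ≡ (a + x) + d
    swap = ℕ-Solver.solve-∀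

  ≡[mod]-common-divisor : ∀ {n d m v y y′} x x′ .{{_ : NonZero n}} → d ℕ.∣ n → d ℕ.∣ m →
                          x % n ≡ (v + m * y) % n → x′ % n ≡ (v + m * y′) % n → x ≡ x′ [mod d ]
  ≡[mod]-common-divisor {n} {zero} _ _ 0∣n _ _ _ = contradiction (ℕ.0∣⇒≡0 0∣n) (ℕ.≢-nonZero⁻¹ n)
  ≡[mod]-common-divisor {n} {d@(suc _)} {m} {v} x x′ d∣n d∣m x≡v+my x′≡v+my′ =
    %≡%⇒≡[mod] x x′ (≡.trans (reduce x≡v+my) (≡.sym (reduce x′≡v+my′)))
    where
    open ≡.≡-Reasoning
    reduce : ∀ {x y} → x % n ≡ (v + m * y) % n → x % d ≡ v % d
    reduce {x} {y} x≡v+my = begin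
      x % d               ≡⟨ m∣n⇒o%n%m≡o%m d n x d∣n ⟨
      x % n % d           ≡⟨ cong (_% d) x≡v+my ⟩
      (v + m * y) % n % d ≡⟨ m∣n⇒o%n%m≡o%m d n (v + m * y) d∣n ⟩
      (v + m * y) % d     ≡⟨ %-remove-+ʳ v (∣m⇒∣m*n y d∣m) ⟩
      v % d               ∎

  coprime⇒unit : ∀ {n m} .{{_ : NonZero n}} → Coprime m n → IsUnitMod n m
  coprime⇒unit {n@(suc n′)} {m} coprime with coprime-Bézout coprime
  ... | Bézout.+- x y 1+yn≡xm = x , %≡%⇒≡[mod] (m * x) 1 (begin
    (m * x) % n       ≡⟨ cong (_% n) (≡.trans (ℕ.*-comm m x) (≡.sym 1+yn≡xm)) ⟩
    (1 + y * n) % n   ≡⟨ [m+kn]%n≡m%n 1 y n ⟩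
    1 % n             ∎)
    where open ≡.≡-Reasoning
  -- Here m x ≡ -1, so x (n - 1) inverts m.
  ... | Bézout.-+ x y 1+xm≡yn = x * n′ , %≡%⇒≡[mod] (m * (x * n′)) 1 (begin
    (m * (x * n′)) % n                   ≡⟨ [m+kn]%n≡m%n (m * (x * n′)) y n ⟨
    (m * (x * n′) + y * n) % n           ≡⟨ cong (λ z → (m * (x * n′) + z) % n) (≡.sym 1+xm≡yn) ⟩
    (m * (x * n′) + (1 + x * m)) % n     ≡⟨ cong (_% n) (regroup m x n′) ⟩
    (1 + (m * x) * n) % n                ≡⟨ [m+kn]%n≡m%n 1 (m * x) n ⟩
    1 % n                                ∎)
    where
    open ≡.≡-Reasoning
    regroup : ∀ m x n′ → m * (x * n′) + (1 + x * m) ≡ 1 + (m * x) * suc n′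
    regroup = ℕ-Solver.solve-∀

open ModularArithmetic

-- MultisetAffineEq with u = m, in the remainder form in which the congruences are obtained.
AffineUpToPermutation : ∀ {r} n .{{_ : NonZero n}} → ℕ → (e f : Fin (suc r) → ℕ) → Set
AffineUpToPermutation {r} n m e f =
  Σ ℕ λ v → Σ (Permutation′ (suc r)) λ σ → ∀ j → e j % n ≡ (v ℕ.+ m ℕ.* f (σ ⟨$⟩ʳ j)) % n

regular-affine⇒unit : ∀ {n r m} {e f : Fin (suc r) → ℕ} .{{_ : NonZero n}} →
                      Regular n r e → AffineUpToPermutation n m e f →
                      Σ ℕ λ v → IsUnitMod n m × MultisetAffineEq n r e f m v
regular-affine⇒unit {n} {m = m} {e} {f} e-regular (v , σ , e≡v+mfσ) =
  v , coprime⇒unit m-coprime-n , σ , λ j → %≡%⇒≡[mod] (e j) (v ℕ.+ m ℕ.* f (σ ⟨$⟩ʳ j)) (e≡v+mfσ j)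
  where
  m-coprime-n : Coprime m n
  m-coprime-n (d∣m , d∣n) = e-regular _ d∣n λ j →
    ≡[mod]-common-divisor {v = v} (e j) (e zero) d∣n d∣m (e≡v+mfσ j) (e≡v+mfσ zero)

module _ {c ℓ} (K : Field c ℓ) where
  open Field K hiding (zero)
  open import Algebra.Properties.Semiring.Sum semiring
    using (sum; sum-remove; sum-cong-≋; sum-replicate-zero; ∑-comm; ∑-distrib-+; *-distribˡ-sum; *-distribʳ-sum)
  open import Algebra.Properties.Semiring.Exp semiring using (_^_; ^-homo-*; ^-assocʳ; ^-congʳ)
  open import Algebra.Properties.Ring ring using (-‿distribˡ-*; -‿distribʳ-*; -‿involutive; +-inverseʳ-unique)
  open import Algebra.Properties.CommutativeSemigroup *-commutativeSemigroup using (x∙yz≈yx∙z; x∙yz≈y∙xz)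
  open import Relation.Binary.Reasoning.Setoid setoid

  *-cancelˡ-invertible : ∀ {x y u v} → x * y ≈ 1# → x * u ≈ x * v → u ≈ v
  *-cancelˡ-invertible {x} {y} {u} {v} xy≈1 xu≈xv = begin
    u             ≈⟨ *-identityˡ u ⟨
    1# * u        ≈⟨ *-congʳ yx≈1 ⟨
    (y * x) * u   ≈⟨ *-assoc y x u ⟩
    y * (x * u)   ≈⟨ *-congˡ xu≈xv ⟩
    y * (x * v)   ≈⟨ *-assoc y x v ⟨
    (y * x) * v   ≈⟨ *-congʳ yx≈1 ⟩
    1# * v        ≈⟨ *-identityˡ v ⟩
    v             ∎
    where
    yx≈1 : y * x ≈ 1#
    yx≈1 = trans (*-comm y x) xy≈1

  private
    infixl 7 _∙_
    infix 4 _≈ᴹ_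
    _∙_ : ∀ {m} → Matrix K m → Matrix K m → Matrix K m
    _∙_ = _⊗_ K
    𝟙 : ∀ {m} → Matrix K m
    𝟙 = identityMatrix K
    _≈ᴹ_ : ∀ {m} → Matrix K m → Matrix K m → Set ℓ
    _≈ᴹ_ = _≈M_ K

  sum-zero : ∀ {m} (g : Fin m → Carrier) → (∀ k → g k ≈ 0#) → sum g ≈ 0#
  sum-zero {m} g g≈0 = trans (sum-cong-≋ g≈0) (sum-replicate-zero m)

  sum-single : ∀ {m} i (g : Fin m → Carrier) → (∀ k → k ≢ i → g k ≈ 0#) → sum g ≈ g i
  sum-single {suc m} i g g≈0 = begin
    sum g                              ≈⟨ sum-remove {i = i} g ⟩
    g i + sum (λ k → g (punchIn i k))  ≈⟨ +-congˡ (sum-zero _ λ k → g≈0 (punchIn i k) (punchInᵢ≢i i k)) ⟩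
    g i + 0#                           ≈⟨ +-identityʳ (g i) ⟩
    g i                                ∎

  diag-≢ : ∀ {m} (d : Fin m → Carrier) {i j} → i ≢ j → diag K d i j ≈ 0#
  diag-≢ d {i} {j} i≢j with i ≟ j
  ... | yes i≡j = contradiction i≡j i≢j
  ... | no  _   = refl

  diag-≡ : ∀ {m} (d : Fin m → Carrier) i → diag K d i i ≈ d i
  diag-≡ d i with i ≟ i
  ... | yes _   = refl
  ... | no  i≢i = contradiction ≡.refl i≢i

  𝟙≈diag : ∀ {m} → 𝟙 {m} ≈ᴹ diag K (λ _ → 1#)
  𝟙≈diag i j with i ≟ j
  ... | yes _ = refl
  ... | no  _ = refl

  𝟙-suc : ∀ {m} (i j : Fin m) → 𝟙 (suc i) (suc j) ≈ 𝟙 i j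
  𝟙-suc i j with i ≟ j
  ... | yes _ = refl
  ... | no  _ = refl

  diag-∙ : ∀ {m} (d : Fin m → Carrier) (X : Matrix K m) i j → (diag K d ∙ X) i j ≈ d i * X i j
  diag-∙ d X i j = begin
    sum (λ k → diag K d i k * X k j)
      ≈⟨ sum-single i _ (λ k k≢i → trans (*-congʳ (diag-≢ d (k≢i ∘ ≡.sym))) (zeroˡ (X k j))) ⟩
    diag K d i i * X i j
      ≈⟨ *-congʳ (diag-≡ d i) ⟩
    d i * X i j
      ∎

  ∙-diag : ∀ {m} (X : Matrix K m) (d : Fin m → Carrier) i j → (X ∙ diag K d) i j ≈ X i j * d j
  ∙-diag X d i j = begin
    sum (λ k → X i k * diag K d k j)
      ≈⟨ sum-single j _ (λ k k≢j → trans (*-congˡ (diag-≢ d k≢j)) (zeroʳ (X i k))) ⟩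
    X i j * diag K d j j
      ≈⟨ *-congˡ (diag-≡ d j) ⟩
    X i j * d j
      ∎

  ∙-congˡ : ∀ {m} (X : Matrix K m) {Y Y′ : Matrix K m} → Y ≈ᴹ Y′ → X ∙ Y ≈ᴹ X ∙ Y′
  ∙-congˡ X Y≈Y′ i j = sum-cong-≋ (λ k → *-congˡ (Y≈Y′ k j))

  ∙-congʳ : ∀ {m} (Y : Matrix K m) {X X′ : Matrix K m} → X ≈ᴹ X′ → X ∙ Y ≈ᴹ X′ ∙ Y
  ∙-congʳ Y X≈X′ i j = sum-cong-≋ (λ k → *-congʳ (X≈X′ i k))

  ∙-identityʳ : ∀ {m} (X : Matrix K m) → X ∙ 𝟙 ≈ᴹ X
  ∙-identityʳ X i j = begin
    (X ∙ 𝟙) i j                   ≈⟨ ∙-congˡ X 𝟙≈diag i j ⟩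
    (X ∙ diag K (λ _ → 1#)) i j   ≈⟨ ∙-diag X (λ _ → 1#) i j ⟩
    X i j * 1#                    ≈⟨ *-identityʳ (X i j) ⟩
    X i j                         ∎

  ∙-assoc : ∀ {m} (X Y Z : Matrix K m) → (X ∙ Y) ∙ Z ≈ᴹ X ∙ (Y ∙ Z)
  ∙-assoc X Y Z i j = begin
    sum (λ k → sum (λ l → X i l * Y l k) * Z k j)
      ≈⟨ sum-cong-≋ (λ k → *-distribʳ-sum (Z k j) (λ l → X i l * Y l k)) ⟩
    sum (λ k → sum (λ l → X i l * Y l k * Z k j))
      ≈⟨ ∑-comm (λ k l → X i l * Y l k * Z k j) ⟩
    sum (λ l → sum (λ k → X i l * Y l k * Z k j))
      ≈⟨ sum-cong-≋ (λ l → sum-cong-≋ (λ k → *-assoc (X i l) (Y l k) (Z k j))) ⟩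
    sum (λ l → sum (λ k → X i l * (Y l k * Z k j)))
      ≈⟨ sum-cong-≋ (λ l → *-distribˡ-sum (X i l) (λ k → Y l k * Z k j)) ⟨
    sum (λ l → X i l * sum (λ k → Y l k * Z k j))
      ∎

  matPow-diag : ∀ {m} (d : Fin m → Carrier) k → matPow K (diag K d) k ≈ᴹ diag K (λ i → d i ^ k)
  matPow-diag d zero    = 𝟙≈diag
  matPow-diag d (suc k) i j = begin
    (diag K d ∙ matPow K (diag K d) k) i j ≈⟨ diag-∙ d (matPow K (diag K d) k) i j ⟩
    d i * matPow K (diag K d) k i j        ≈⟨ *-congˡ (matPow-diag d k i j) ⟩
    d i * diag K (λ i → d i ^ k) i j       ≈⟨ scale-diag ⟩
    diag K (λ i → d i ^ suc k) i j         ∎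
    where
    scale-diag : d i * diag K (λ i → d i ^ k) i j ≈ diag K (λ i → d i ^ suc k) i j
    scale-diag with i ≟ j
    ... | yes _ = refl
    ... | no  _ = zeroʳ (d i)

  sum-linear : ∀ {m} (x y z : Fin m → Carrier) c →
               sum (λ k → x k * (y k + z k * c)) ≈ sum (λ k → x k * y k) + sum (λ k → x k * z k) * c
  sum-linear x y z c = begin
    sum (λ k → x k * (y k + z k * c))
      ≈⟨ sum-cong-≋ (λ k → trans (distribˡ (x k) (y k) (z k * c)) (+-congˡ (sym (*-assoc (x k) (z k) c)))) ⟩
    sum (λ k → x k * y k + x k * z k * c)
      ≈⟨ ∑-distrib-+ (λ k → x k * y k) (λ k → x k * z k * c) ⟩
    sum (λ k → x k * y k) + sum (λ k → x k * z k * c)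
      ≈⟨ +-congˡ (*-distribʳ-sum c (λ k → x k * z k)) ⟨
    sum (λ k → x k * y k) + sum (λ k → x k * z k) * c
      ∎

  ∙-cancel-leftInverse : ∀ {m} {A B : Matrix K m} (X : Matrix K m) → B ∙ A ≈ᴹ 𝟙 → (X ∙ B) ∙ A ≈ᴹ X
  ∙-cancel-leftInverse {A = A} {B} X BA≈𝟙 i j =
    trans (∙-assoc X B A i j) (trans (∙-congˡ X BA≈𝟙 i j) (∙-identityʳ X i j))

  Intertwines : ∀ {m} → Matrix K m → (Fin m → Carrier) → (Fin m → Carrier) → Set ℓ
  Intertwines A a b = ∀ i j → A i j * a j ≈ b i * A i j

  conjugate-intertwines : ∀ {m μ} (A B : Matrix K m) {a b : Fin m → Carrier} k → B ∙ A ≈ᴹ 𝟙 →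
                          (∀ i j → matPow K (diag K b) k i j ≈ μ * ((A ∙ diag K a) ∙ B) i j) →
                          Intertwines A (λ j → μ * a j) (λ i → b i ^ k)
  conjugate-intertwines {μ = μ} A B {a} {b} k BA≈𝟙 bᵏ≈μAaB i j = begin
    A i j * (μ * a j)
      ≈⟨ x∙yz≈y∙xz (A i j) μ (a j) ⟩
    μ * (A i j * a j)
      ≈⟨ *-congˡ (∙-diag A a i j) ⟨
    μ * (A ∙ diag K a) i j
      ≈⟨ *-congˡ (∙-cancel-leftInverse (A ∙ diag K a) BA≈𝟙 i j) ⟨
    μ * ((A ∙ diag K a) ∙ B ∙ A) i j
      ≈⟨ *-distribˡ-sum μ (λ l → ((A ∙ diag K a) ∙ B) i l * A l j) ⟩
    sum (λ l → μ * (((A ∙ diag K a) ∙ B) i l * A l j))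
      ≈⟨ sum-cong-≋ (λ l → trans (*-congʳ (bᵏ≈μAaB i l)) (*-assoc μ _ _)) ⟨
    (matPow K (diag K b) k ∙ A) i j
      ≈⟨ ∙-congʳ A (matPow-diag b k) i j ⟩
    (diag K (λ i → b i ^ k) ∙ A) i j
      ≈⟨ diag-∙ (λ i → b i ^ k) A i j ⟩
    b i ^ k * A i j
      ∎

  ¬¬-column-nonzero : ∀ {m} (A B : Matrix K m) → B ∙ A ≈ᴹ 𝟙 → ∀ j → ¬ ¬ Σ (Fin m) λ i → ¬ A i j ≈ 0#
  ¬¬-column-nonzero A B BA≈𝟙 j no-pivot =
    sequence (RawMonad.rawApplicative (¬¬-Monad {ℓ})) (λ i Aij≉0 → no-pivot (i , Aij≉0)) column-not-zero
    where
    column-not-zero : ¬ (∀ i → A i j ≈ 0#)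
    column-not-zero Aⱼ≈0 = 1≉0 (begin
      1#          ≈⟨ trans (𝟙≈diag j j) (diag-≡ _ j) ⟨
      𝟙 j j       ≈⟨ BA≈𝟙 j j ⟨
      (B ∙ A) j j ≈⟨ sum-zero _ (λ k → trans (*-congˡ (Aⱼ≈0 k)) (zeroʳ (B j k))) ⟩
      0#          ∎)

  minor : ∀ {m} → Matrix K (suc m) → Fin (suc m) → Fin (suc m) → Matrix K m
  minor M i j k l = M (punchIn i k) (punchIn j l)

  -- The Schur complement of the pivot A i 0 (q being its inverse): clear row i by adding multiples
  -- of column 0 to the other columns, then delete row i and column 0.
  eliminate : ∀ {m} → Matrix K (suc m) → Fin (suc m) → Carrier → Matrix K m
  eliminate A i q k l = A (punchIn i k) (suc l) + A (punchIn i k) zero * - (q * A i (suc l))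

  eliminate-intertwines : ∀ {m} {A : Matrix K (suc m)} {a b i} q → a zero ≈ b i → Intertwines A a b →
                          Intertwines (eliminate A i q) (a ∘ suc) (b ∘ punchIn i)
  eliminate-intertwines {A = A} {a} {b} {i} q a₀≈bᵢ A⇄ k l = begin
    (x + y * γ) * a′                ≈⟨ distribʳ a′ x (y * γ) ⟩
    x * a′ + (y * γ) * a′           ≈⟨ +-cong (A⇄ (punchIn i k) (suc l)) pivot-column-term ⟩
    b′ * x + b′ * (y * γ)           ≈⟨ distribˡ b′ x (y * γ) ⟨
    b′ * (x + y * γ)                ∎
    where
    x y γ a′ b′ : Carrier
    x = A (punchIn i k) (suc l)
    y = A (punchIn i k) zero
    γ = - (q * A i (suc l))
    a′ = a (suc l)
    b′ = b (punchIn i k)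
    γ-commutes : γ * a′ ≈ b i * γ
    γ-commutes = begin
      - (q * A i (suc l)) * a′       ≈⟨ -‿distribˡ-* (q * A i (suc l)) a′ ⟨
      - (q * A i (suc l) * a′)       ≈⟨ -‿cong (*-assoc q (A i (suc l)) a′) ⟩
      - (q * (A i (suc l) * a′))     ≈⟨ -‿cong (*-congˡ (A⇄ i (suc l))) ⟩
      - (q * (b i * A i (suc l)))    ≈⟨ -‿cong (x∙yz≈y∙xz q (b i) (A i (suc l))) ⟩
      - (b i * (q * A i (suc l)))    ≈⟨ -‿distribʳ-* (b i) (q * A i (suc l)) ⟩
      b i * γ                        ∎
    pivot-column-term : (y * γ) * a′ ≈ b′ * (y * γ)
    pivot-column-term = begin
      (y * γ) * a′    ≈⟨ *-assoc y γ a′ ⟩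
      y * (γ * a′)    ≈⟨ *-congˡ γ-commutes ⟩
      y * (b i * γ)   ≈⟨ *-assoc y (b i) γ ⟨
      (y * b i) * γ   ≈⟨ *-congʳ (*-congˡ a₀≈bᵢ) ⟨
      (y * a zero) * γ ≈⟨ *-congʳ (A⇄ (punchIn i k) zero) ⟩
      (b′ * y) * γ    ≈⟨ *-assoc b′ y γ ⟩
      b′ * (y * γ)    ∎

  eliminate-leftInverse : ∀ {m} (A B : Matrix K (suc m)) {i q} → A i zero * q ≈ 1# → B ∙ A ≈ᴹ 𝟙 →
                          minor B zero i ∙ eliminate A i q ≈ᴹ 𝟙
  eliminate-leftInverse {m} A B {i} {q} pq≈1 BA≈𝟙 l l′ = begin
    sum (λ k → B′ k * (A (punchIn i k) (suc l′) + A (punchIn i k) zero * - (q * w)))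
      ≈⟨ sum-linear B′ (λ k → A (punchIn i k) (suc l′)) (λ k → A (punchIn i k) zero) (- (q * w)) ⟩
    S₁ + S₀ * - (q * w)            ≈⟨ +-congˡ (*-congʳ S₀≈-up) ⟩
    S₁ + - (u * p) * - (q * w)     ≈⟨ +-congˡ (-‿distribˡ-* (u * p) (- (q * w))) ⟨
    S₁ + - (u * p * - (q * w))     ≈⟨ +-congˡ (-‿cong (-‿distribʳ-* (u * p) (q * w))) ⟨
    S₁ + - - (u * p * (q * w))     ≈⟨ +-congˡ (-‿involutive (u * p * (q * w))) ⟩
    S₁ + u * p * (q * w)           ≈⟨ +-congˡ upqw≈uw ⟩
    S₁ + u * w                     ≈⟨ +-comm S₁ (u * w) ⟩
    u * w + S₁                     ≈⟨ uw+S₁≈𝟙 ⟩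
    𝟙 l l′                         ∎
    where
    B′ : Fin m → Carrier
    B′ = minor B zero i l
    u p w S₁ S₀ : Carrier
    u = B (suc l) i
    p = A i zero
    w = A i (suc l′)
    S₁ = sum (λ k → B′ k * A (punchIn i k) (suc l′))
    S₀ = sum (λ k → B′ k * A (punchIn i k) zero)
    uw+S₁≈𝟙 : u * w + S₁ ≈ 𝟙 l l′
    uw+S₁≈𝟙 = trans (sym (sum-remove {i = i} (λ k → B (suc l) k * A k (suc l′))))
                    (trans (BA≈𝟙 (suc l) (suc l′)) (𝟙-suc l l′))
    S₀≈-up : S₀ ≈ - (u * p)
    S₀≈-up = +-inverseʳ-unique (u * p) S₀
               (trans (sym (sum-remove {i = i} (λ k → B (suc l) k * A k zero))) (BA≈𝟙 (suc l) zero))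
    upqw≈uw : u * p * (q * w) ≈ u * w
    upqw≈uw = begin
      u * p * (q * w)    ≈⟨ *-assoc u p (q * w) ⟩
      u * (p * (q * w))  ≈⟨ *-congˡ (*-assoc p q w) ⟨
      u * (p * q * w)    ≈⟨ *-congˡ (*-congʳ pq≈1) ⟩
      u * (1# * w)       ≈⟨ *-congˡ (*-identityˡ w) ⟩
      u * w              ∎

  intertwined-diagonals-match : ∀ {m} (A B : Matrix K m) {a b} → B ∙ A ≈ᴹ 𝟙 → Intertwines A a b →
                                ¬ ¬ Matching m (λ j i → a j ≈ b i)
  intertwined-diagonals-match {zero} _ _ _ _ = pure tt
    where open RawMonad (¬¬-Monad {ℓ})
  intertwined-diagonals-match {suc m} A B {a} {b} BA≈𝟙 A⇄ = do
      (i , pivot≉0) ← ¬¬-column-nonzero A B BA≈𝟙 zero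
      let (q , pivot*q≈1) = inverse (A i zero) pivot≉0
          a₀≈bᵢ = *-cancelˡ-invertible pivot*q≈1 (trans (A⇄ i zero) (*-comm (b i) (A i zero)))
      rest ← intertwined-diagonals-match (eliminate A i q) (minor B zero i)
               (eliminate-leftInverse A B pivot*q≈1 BA≈𝟙) (eliminate-intertwines q a₀≈bᵢ A⇄)
      pure (i , a₀≈bᵢ , rest)
    where open RawMonad (¬¬-Monad {ℓ})


  scaled-powers : ∀ {μ x} a b c d → μ * x ^ a ≈ x ^ c → μ * x ^ b ≈ x ^ d →
                  x ^ (b ℕ.+ c) ≈ x ^ (a ℕ.+ d)
  scaled-powers {μ} {x} a b c d μxᵃ≈xᶜ μxᵇ≈xᵈ = begin
    x ^ (b ℕ.+ c)       ≈⟨ ^-homo-* x b c ⟩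
    x ^ b * x ^ c       ≈⟨ *-congˡ μxᵃ≈xᶜ ⟨
    x ^ b * (μ * x ^ a) ≈⟨ x∙yz≈yx∙z (x ^ b) μ (x ^ a) ⟩
    (μ * x ^ b) * x ^ a ≈⟨ *-congʳ μxᵇ≈xᵈ ⟩
    x ^ d * x ^ a       ≈⟨ *-comm (x ^ d) (x ^ a) ⟩
    x ^ a * x ^ d       ≈⟨ ^-homo-* x a d ⟨
    x ^ (a ℕ.+ d)       ∎

  module _ {n β} (β-primitive : IsPrimitiveRoot K n β) where

    ^-multiple-of-order : ∀ k → β ^ (k ℕ.* n) ≈ 1#
    ^-multiple-of-order zero    = refl
    ^-multiple-of-order (suc k) = begin
      β ^ (n ℕ.+ k ℕ.* n)   ≈⟨ ^-homo-* β n (k ℕ.* n) ⟩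
      β ^ n * β ^ (k ℕ.* n) ≈⟨ *-cong (proj₁ β-primitive) (^-multiple-of-order k) ⟩
      1# * 1#               ≈⟨ *-identityˡ 1# ⟩
      1#                    ∎

    ^-inverse : .{{_ : NonZero n}} → ∀ k → β ^ k * β ^ (pred n ℕ.* k) ≈ 1#
    ^-inverse k = begin
      β ^ k * β ^ (pred n ℕ.* k)  ≈⟨ ^-homo-* β k (pred n ℕ.* k) ⟨
      β ^ (suc (pred n) ℕ.* k)    ≈⟨ ^-congʳ β (≡.trans (cong (ℕ._* k) (ℕ.suc-pred n)) (ℕ.*-comm n k)) ⟩
      β ^ (k ℕ.* n)               ≈⟨ ^-multiple-of-order k ⟩
      1#                          ∎

    ^-% : .{{_ : NonZero n}} → ∀ x → β ^ x ≈ β ^ (x % n)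
    ^-% x = begin
      β ^ x                             ≈⟨ ^-congʳ β (m≡m%n+[m/n]*n x n) ⟩
      β ^ (x % n ℕ.+ x / n ℕ.* n)       ≈⟨ ^-homo-* β (x % n) (x / n ℕ.* n) ⟩
      β ^ (x % n) * β ^ (x / n ℕ.* n)   ≈⟨ *-congˡ (^-multiple-of-order (x / n)) ⟩
      β ^ (x % n) * 1#                  ≈⟨ *-identityʳ (β ^ (x % n)) ⟩
      β ^ (x % n)                       ∎

    ^≈1⇒≡0 : ∀ {d} → d < n → β ^ d ≈ 1# → d ≡ 0
    ^≈1⇒≡0 {zero}  _   _     = ≡.refl
    ^≈1⇒≡0 {suc d} d<n βᵈ≈1 = ⊥-elim (proj₂ β-primitive (suc d) (s≤s z≤n) d<n βᵈ≈1)

    ^-cancel-+ : .{{_ : NonZero n}} → ∀ r d → β ^ (r ℕ.+ d) ≈ β ^ r → β ^ d ≈ 1#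
    ^-cancel-+ r d βʳ⁺ᵈ≈βʳ = *-cancelˡ-invertible (^-inverse r) (begin
      β ^ r * β ^ d     ≈⟨ ^-homo-* β r d ⟨
      β ^ (r ℕ.+ d)     ≈⟨ βʳ⁺ᵈ≈βʳ ⟩
      β ^ r             ≈⟨ *-identityʳ (β ^ r) ⟨
      β ^ r * 1#        ∎)

    ^-injective-≤ : .{{_ : NonZero n}} → ∀ {r s} → s ≤ r → r < n → β ^ r ≈ β ^ s → r ≡ s
    ^-injective-≤ {r} {s} s≤r r<n βʳ≈βˢ = ℕ.≤-antisym (ℕ.m∸n≡0⇒m≤n r∸s≡0) s≤r
      where
      βˢ⁺⁽ʳ⁻ˢ⁾≈βˢ : β ^ (s ℕ.+ (r ℕ.∸ s)) ≈ β ^ s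
      βˢ⁺⁽ʳ⁻ˢ⁾≈βˢ = trans (^-congʳ β (ℕ.m+[n∸m]≡n s≤r)) βʳ≈βˢ
      r∸s≡0 : r ℕ.∸ s ≡ 0
      r∸s≡0 = ^≈1⇒≡0 (ℕ.≤-<-trans (ℕ.m∸n≤m r s) r<n) (^-cancel-+ s (r ℕ.∸ s) βˢ⁺⁽ʳ⁻ˢ⁾≈βˢ)

    ^-injective-< : .{{_ : NonZero n}} → ∀ {r s} → r < n → s < n → β ^ r ≈ β ^ s → r ≡ s
    ^-injective-< {r} {s} r<n s<n βʳ≈βˢ with ℕ.≤-total s r
    ... | inj₁ s≤r = ^-injective-≤ s≤r r<n βʳ≈βˢ
    ... | inj₂ r≤s = ≡.sym (^-injective-≤ r≤s s<n (sym βʳ≈βˢ))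

    ^-≈⇒%≡% : .{{_ : NonZero n}} → ∀ x y → β ^ x ≈ β ^ y → x % n ≡ y % n
    ^-≈⇒%≡% x y βˣ≈βʸ =
      ^-injective-< (m%n<n x n) (m%n<n y n) (trans (sym (^-% x)) (trans βˣ≈βʸ (^-% y)))

    scaled-powers⇒%≡ : .{{_ : NonZero n}} → ∀ {μ} m a b x y →
                       μ * β ^ a ≈ (β ^ x) ^ m → μ * β ^ b ≈ (β ^ y) ^ m →
                       b % n ≡ ((a ℕ.+ pred n ℕ.* (m ℕ.* x)) ℕ.+ m ℕ.* y) % n
    scaled-powers⇒%≡ m a b x y μβᵃ≈βˣᵐ μβᵇ≈βʸᵐ = %-transpose a b (m ℕ.* x) (m ℕ.* y)
      (^-≈⇒%≡% (b ℕ.+ m ℕ.* x) (a ℕ.+ m ℕ.* y)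
        (scaled-powers a b (m ℕ.* x) (m ℕ.* y) (trans μβᵃ≈βˣᵐ (^-^ x)) (trans μβᵇ≈βʸᵐ (^-^ y))))
      where
      ^-^ : ∀ x → (β ^ x) ^ m ≈ β ^ (m ℕ.* x)
      ^-^ x = trans (^-assocʳ β x m) (^-congʳ β (ℕ.*-comm x m))

    matched-scaled-powers⇒affine : .{{_ : NonZero n}} → ∀ {r μ} m (e f : Fin (suc r) → ℕ) →
                                   ¬ ¬ Matching (suc r) (λ j i → μ * β ^ e j ≈ (β ^ f i) ^ m) →
                                   AffineUpToPermutation n m e f
    matched-scaled-powers⇒affine {r} {μ} m e f ¬¬matched = affine (decidable-stable
      (any? λ k → matching? {R = Congruent k} (congruent? k)) (¬¬-map partner-congruences ¬¬matched))
      where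
      offset : Fin (suc r) → ℕ
      offset k = e zero ℕ.+ pred n ℕ.* (m ℕ.* f k)
      Congruent : Fin (suc r) → Fin (suc r) → Fin (suc r) → Set
      Congruent k j i = e j % n ≡ (offset k ℕ.+ m ℕ.* f i) % n
      congruent? : ∀ k j i → Dec (Congruent k j i)
      congruent? k j i = e j % n ℕ.≟ (offset k ℕ.+ m ℕ.* f i) % n
      partner-congruences : Matching (suc r) (λ j i → μ * β ^ e j ≈ (β ^ f i) ^ m) →
                            Σ (Fin (suc r)) λ k → Matching (suc r) (Congruent k)
      partner-congruences M@(k , μβᵉ⁰≈βᶠᵏᵐ , _) =
        k , mapMatching (λ j i → scaled-powers⇒%≡ m (e zero) (e j) (f k) (f i) μβᵉ⁰≈βᶠᵏᵐ) M
      affine : Σ (Fin (suc r)) (λ k → Matching (suc r) (Congruent k)) → AffineUpToPermutation n m e f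
      affine (k , M) = offset k , matching⇒permutation {R = Congruent k} M

theorem5p2 : {c ℓ : Level} (K : Field c ℓ) (n : ℕ) → 1 ≤ n →
    (β : Field.Carrier K) → IsPrimitiveRoot K n β →
    (r : ℕ) → 1 ≤ r →
    (e f : Fin (suc r) → ℕ) → Regular n r e → Regular n r f →
    (A B : Matrix K (suc r)) →
    _≈M_ K (_⊗_ K A B) (identityMatrix K) → _≈M_ K (_⊗_ K B A) (identityMatrix K) →
    MapsMomentSet K β A e f → ConjInCyclic K β A B e f →
    Σ ℕ λ u → Σ ℕ λ v → IsUnitMod n u × MultisetAffineEq n r e f u v
theorem5p2 K (suc _) _ β β-primitive r _ e f e-regular _ A B _ BA≈I _ (m , μ , _ , conjugate) =
  m , regular-affine⇒unit {m = m} {f = f} e-regular (matched-scaled-powers⇒affine K β-primitive m e f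
        (intertwined-diagonals-match K A B BA≈I (conjugate-intertwines K A B m BA≈I conjugate)))
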